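{- If $N$ is even, then $\mathrm{FSh}_2(N)=\{0\}$.
   Context: For $N \geq 0$, let $V'_N \subset \mathbb Q(X,Y)$ be the space of rational functions homogeneous of degree $N-2$ having at most simple poles along $X=0$ and $Y=0$ and no other poles, i.e. $V'_N=\{f \in \mathbb Q(X,Y)_{N-2} \mid XY\cdot f \in \mathbb Q[X,Y]\}$. The length two Fay-shuffle space $\mathrm{FSh}_2(N)$ is the set of $P \in V'_N$ satisfying $P(X,Y)+P(X+Y,-Y)+P(-X-Y,X)=0$ and $P(X,Y)+P(Y,X)=0$. -}

module Defs where

open import Data.Nat as ℕ using (ℕ; zero; suc; _∸_)
open import Data.Fin using (Fin; toℕ)
open import Data.Rational using (ℚ; 0ℚ; 1ℚ; _+_; _*_; -_; 1/_; ≢-nonZero)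
open import Data.Rational.Properties using (_≟_)
open import Data.Product using (_×_)
open import Relation.Nullary using (yes; no)
open import Relation.Binary.PropositionalEquality using (_≡_; _≢_)

_^_ : ℚ → ℕ → ℚ
x ^ zero = 1ℚ
x ^ suc n = x * (x ^ n)

∑ : ∀ {n} → (Fin n → ℚ) → ℚ
∑ {zero} f = 0ℚ
∑ {suc n} f = f Fin.zero + ∑ (λ i → f (Fin.suc i))

-- total inverse (value at 0 is irrelevant: only used at nonzero points)
inv : ℚ → ℚ
inv q with q ≟ 0ℚ
... | yes _ = 0ℚ
... | no q≢0 = 1/_ q {{≢-nonZero q≢0}}

-- An element of V'_N is f = g / (X Y) with g a homogeneous polynomial of
-- degree N in ℚ[X,Y]; it is represented by the coefficients of g:
-- c i is the coefficient of X^i Y^(N-i).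
V' : ℕ → Set
V' N = Fin (suc N) → ℚ

numer : (N : ℕ) → V' N → ℚ → ℚ → ℚ
numer N c x y = ∑ (λ (i : Fin (suc N)) → c i * ((x ^ toℕ i) * (y ^ (N ∸ toℕ i))))

ev : (N : ℕ) → V' N → ℚ → ℚ → ℚ
ev N c x y = numer N c x y * inv (x * y)

-- P ∈ FSh₂(N): the two functional equations, as identities of rational
-- functions, i.e. holding at every point where all terms are defined.
FSh₂ : (N : ℕ) → V' N → Set
FSh₂ N c =
  (∀ x y → x ≢ 0ℚ → y ≢ 0ℚ → x + y ≢ 0ℚ →
     ev N c x y + ev N c (x + y) (- y) + ev N c (- x + - y) x ≡ 0ℚ)
  × (∀ x y → x ≢ 0ℚ → y ≢ 0ℚ → ev N c x y + ev N c y x ≡ 0ℚ)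

IsZero : (N : ℕ) → V' N → Set
IsZero N c = ∀ i → c i ≡ 0ℚ

module Submission where

-- For N even,
-- g(-x,-y) = g(x,y) and (-x)(-y) = xy, so P is an even function.  Evenness turns
-- the third Fay term P(-x-y, x) into P(x+y, -x); the Fay relations at (x,y) and
-- at (y,x) then contain the same two terms P(x+y,-x), P(x+y,-y), and subtracting
-- them gives P(x,y) = P(y,x).  Together with antisymmetry this forces
-- 2·P(x,y) = 0, hence g(x,y) = 0 whenever x, y, x+y ≠ 0.  In particular the
-- one-variable polynomial g(x,1) vanishes at every positive rational, and such a
-- polynomial has zero coefficients (proved by comparing its values at 2x and x).

open import Defs
open import Data.Nat using (ℕ)
open import Data.Nat.Divisibility using (_∣_)

open import Data.Nat as ℕ using (zero; suc; _∸_)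
open import Data.Nat.Properties using (m+[n∸m]≡n)
open import Data.Nat.Divisibility using (divides)
open import Data.Fin as Fin using (Fin; toℕ)
open import Data.Fin.Properties using (toℕ≤pred[n])
open import Data.Rational using (ℚ; 0ℚ; 1ℚ; _+_; _*_; -_; _-_; ≢-nonZero; _<_; _≤_)
open import Data.Rational.Properties
  using (_≟_; _<?_; 1≢0; +-*-commutativeRing; heytingCommutativeRing; *-inverseˡ;
         *-identityˡ; *-identityʳ; *-zeroˡ; +-comm;
         <⇒≢; <⇒≤; ≤-reflexive; ≤-trans; <-≤-trans; +-mono-<; +-mono-≤)
open import Data.Maybe using (Maybe; just; nothing)
open import Data.Product using (_,_)
open import Data.Empty using (⊥-elim)
open import Relation.Nullary using (yes; no)
open import Relation.Nullary.Decidable using (toWitness)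
open import Relation.Binary.PropositionalEquality
open import Level using (0ℓ)
open import Algebra.Bundles using (CommutativeRing)
open import Algebra.Apartness.Properties.HeytingCommutativeRing heytingCommutativeRing
  using (x#0y#0→xy#0)
import Algebra.Properties.CommutativeSemiring.Exp as Exp
import Algebra.Properties.Semiring.Sum as Sum
open import Tactic.RingSolver using (solve-∀)
open import Tactic.RingSolver.Core.AlmostCommutativeRing
  using (AlmostCommutativeRing; fromCommutativeRing)

open ≡-Reasoning

ℚ-ring : AlmostCommutativeRing 0ℓ 0ℓ
ℚ-ring = fromCommutativeRing +-*-commutativeRing is-zero?
  where
  is-zero? : ∀ x → Maybe (0ℚ ≡ x)
  is-zero? x with 0ℚ ≟ x
  ... | yes p = just p
  ... | no _ = nothing

two : ℚ
two = 1ℚ + 1ℚ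

twice : ∀ a → a + a ≡ two * a
twice = solve-∀ ℚ-ring

*-nonzero : ∀ {x y} → x ≢ 0ℚ → y ≢ 0ℚ → x * y ≢ 0ℚ
*-nonzero = x#0y#0→xy#0

*-cancelˡ-zero : ∀ {x y} → x ≢ 0ℚ → x * y ≡ 0ℚ → y ≡ 0ℚ
*-cancelˡ-zero {x} {y} x≢0 xy≡0 with y ≟ 0ℚ
... | yes y≡0 = y≡0
... | no  y≢0 = ⊥-elim (*-nonzero x≢0 y≢0 xy≡0)

inv-inverseˡ : ∀ q → q ≢ 0ℚ → inv q * q ≡ 1ℚ
inv-inverseˡ q q≢0 with q ≟ 0ℚ
... | yes q≡0 = ⊥-elim (q≢0 q≡0)
... | no  q≢0 = *-inverseˡ q {{≢-nonZero q≢0}}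

two≢0 : two ≢ 0ℚ
two≢0 ()

double-zero : ∀ {a} → a + a ≡ 0ℚ → a ≡ 0ℚ
double-zero {a} a+a≡0 = *-cancelˡ-zero two≢0 (trans (sym (twice a)) a+a≡0)

positive⇒nonzero : ∀ {x} → 0ℚ < x → x ≢ 0ℚ
positive⇒nonzero 0<x x≡0 = <⇒≢ 0<x (sym x≡0)

0<1 : 0ℚ < 1ℚ
0<1 = toWitness {a? = 0ℚ <? 1ℚ} _

1<2 : 1ℚ < two
1<2 = toWitness {a? = 1ℚ <? two} _

module ℚ-Exp = Exp (CommutativeRing.commutativeSemiring +-*-commutativeRing)
module ℚ-Sum = Sum (CommutativeRing.semiring +-*-commutativeRing)

^-agrees : ∀ x n → x ^ n ≡ x ℚ-Exp.^ n
^-agrees x zero = refl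
^-agrees x (suc n) = cong (x *_) (^-agrees x n)

^-distrib-* : ∀ x y n → (x * y) ^ n ≡ x ^ n * y ^ n
^-distrib-* x y n = begin
  (x * y) ^ n                    ≡⟨ ^-agrees (x * y) n ⟩
  (x * y) ℚ-Exp.^ n              ≡⟨ ℚ-Exp.^-distrib-* x y n ⟩
  x ℚ-Exp.^ n * y ℚ-Exp.^ n      ≡⟨ cong₂ _*_ (^-agrees x n) (^-agrees y n) ⟨
  x ^ n * y ^ n                  ∎

^-homo-+ : ∀ x m n → x ^ (m ℕ.+ n) ≡ x ^ m * x ^ n
^-homo-+ x m n = begin
  x ^ (m ℕ.+ n)                  ≡⟨ ^-agrees x (m ℕ.+ n) ⟩
  x ℚ-Exp.^ (m ℕ.+ n)            ≡⟨ ℚ-Exp.^-homo-* x m n ⟩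
  x ℚ-Exp.^ m * x ℚ-Exp.^ n      ≡⟨ cong₂ _*_ (^-agrees x m) (^-agrees x n) ⟨
  x ^ m * x ^ n                  ∎

1^n≡1 : ∀ n → 1ℚ ^ n ≡ 1ℚ
1^n≡1 zero = refl
1^n≡1 (suc n) = trans (cong (1ℚ *_) (1^n≡1 n)) (*-identityˡ 1ℚ)

-- Even powers of -1 are 1; this is where the parity of N enters.
-1^even≡1 : ∀ q → (- 1ℚ) ^ (q ℕ.* 2) ≡ 1ℚ
-1^even≡1 zero = refl
-1^even≡1 (suc q) = cong (λ p → - 1ℚ * (- 1ℚ * p)) (-1^even≡1 q)

two≤twice : ∀ {a} → 1ℚ ≤ a → two ≤ two * a
two≤twice {a} 1≤a = ≤-trans (+-mono-≤ 1≤a 1≤a) (≤-reflexive (twice a))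

1≤2^n : ∀ n → 1ℚ ≤ two ^ n
1≤2^n zero = ≤-reflexive refl
1≤2^n (suc n) = ≤-trans (<⇒≤ 1<2) (two≤twice (1≤2^n n))

1<2^[1+n] : ∀ n → 1ℚ < two ^ suc n
1<2^[1+n] n = <-≤-trans 1<2 (two≤twice (1≤2^n n))

2^[1+n]-1≢0 : ∀ n → two ^ suc n - 1ℚ ≢ 0ℚ
2^[1+n]-1≢0 n eq = <⇒≢ (1<2^[1+n] n) (sym (begin
  two ^ suc n                    ≡⟨ shift (two ^ suc n) ⟩
  (two ^ suc n - 1ℚ) + 1ℚ        ≡⟨ cong (_+ 1ℚ) eq ⟩
  1ℚ                             ∎))
  where
  shift : ∀ a → a ≡ (a - 1ℚ) + 1ℚ
  shift = solve-∀ ℚ-ring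

∑-agrees : ∀ {n} (f : Fin n → ℚ) → ∑ f ≡ ℚ-Sum.sum f
∑-agrees {zero} f = refl
∑-agrees {suc n} f = cong (f Fin.zero +_) (∑-agrees (λ i → f (Fin.suc i)))

∑-cong : ∀ {n} {f g : Fin n → ℚ} → (∀ i → f i ≡ g i) → ∑ f ≡ ∑ g
∑-cong {f = f} {g} f≗g = begin
  ∑ f           ≡⟨ ∑-agrees f ⟩
  ℚ-Sum.sum f   ≡⟨ ℚ-Sum.sum-cong-≗ f≗g ⟩
  ℚ-Sum.sum g   ≡⟨ ∑-agrees g ⟨
  ∑ g           ∎

∑-scale : ∀ {n} a (f : Fin n → ℚ) → a * ∑ f ≡ ∑ (λ i → a * f i)
∑-scale a f = begin
  a * ∑ f                        ≡⟨ cong (a *_) (∑-agrees f) ⟩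
  a * ℚ-Sum.sum f                ≡⟨ ℚ-Sum.*-distribˡ-sum a f ⟩
  ℚ-Sum.sum (λ i → a * f i)      ≡⟨ ∑-agrees (λ i → a * f i) ⟨
  ∑ (λ i → a * f i)              ∎

∑-distrib-+ : ∀ {n} (f g : Fin n → ℚ) → ∑ (λ i → f i + g i) ≡ ∑ f + ∑ g
∑-distrib-+ f g = begin
  ∑ (λ i → f i + g i)            ≡⟨ ∑-agrees (λ i → f i + g i) ⟩
  ℚ-Sum.sum (λ i → f i + g i)    ≡⟨ ℚ-Sum.∑-distrib-+ f g ⟩
  ℚ-Sum.sum f + ℚ-Sum.sum g      ≡⟨ cong₂ _+_ (∑-agrees f) (∑-agrees g) ⟨
  ∑ f + ∑ g                      ∎

∑-zero : ∀ {n} {f : Fin n → ℚ} → (∀ i → f i ≡ 0ℚ) → ∑ f ≡ 0ℚ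
∑-zero {n} {f} f≗0 = begin
  ∑ f                            ≡⟨ ∑-cong f≗0 ⟩
  ∑ {n} (λ _ → 0ℚ)               ≡⟨ ∑-agrees {n} (λ _ → 0ℚ) ⟩
  ℚ-Sum.sum {n} (λ _ → 0ℚ)       ≡⟨ ℚ-Sum.sum-replicate-zero n ⟩
  0ℚ                             ∎

pol : (M : ℕ) → (Fin (suc M) → ℚ) → ℚ → ℚ
pol M c x = ∑ (λ i → c i * x ^ toℕ i)

pol-horner : ∀ M (c : Fin (suc (suc M)) → ℚ) x →
  pol (suc M) c x ≡ c Fin.zero + x * pol M (λ i → c (Fin.suc i)) x
pol-horner M c x = begin
  c Fin.zero * 1ℚ + ∑ (λ i → c (Fin.suc i) * (x * x ^ toℕ i))
    ≡⟨ cong₂ _+_ (*-identityʳ (c Fin.zero)) (∑-cong (λ i → swap (c (Fin.suc i)) x (x ^ toℕ i))) ⟩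
  c Fin.zero + ∑ (λ i → x * (c (Fin.suc i) * x ^ toℕ i))
    ≡⟨ cong (c Fin.zero +_) (∑-scale x (λ i → c (Fin.suc i) * x ^ toℕ i)) ⟨
  c Fin.zero + x * pol M (λ i → c (Fin.suc i)) x
    ∎
  where
  swap : ∀ a x p → a * (x * p) ≡ x * (a * p)
  swap = solve-∀ ℚ-ring

pol-doubling : ∀ M (c : Fin (suc M) → ℚ) x →
  two * pol M c (two * x) - pol M c x ≡ pol M (λ i → (two ^ suc (toℕ i) - 1ℚ) * c i) x
pol-doubling M c x = begin
  two * ∑ f - ∑ g                          ≡⟨ as-combination (∑ f) (∑ g) ⟩
  two * ∑ f + - 1ℚ * ∑ g                   ≡⟨ cong₂ _+_ (∑-scale two f) (∑-scale (- 1ℚ) g) ⟩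
  ∑ (λ i → two * f i) + ∑ (λ i → - 1ℚ * g i)
                                           ≡⟨ ∑-distrib-+ (λ i → two * f i) (λ i → - 1ℚ * g i) ⟨
  ∑ (λ i → two * f i + - 1ℚ * g i)         ≡⟨ ∑-cong term ⟩
  pol M (λ i → (two ^ suc (toℕ i) - 1ℚ) * c i) x ∎
  where
  f g : Fin (suc M) → ℚ
  f i = c i * (two * x) ^ toℕ i
  g i = c i * x ^ toℕ i
  as-combination : ∀ s t → two * s - t ≡ two * s + - 1ℚ * t
  as-combination = solve-∀ ℚ-ring
  collect : ∀ a t p → two * (a * (t * p)) + - 1ℚ * (a * p) ≡ (two * t - 1ℚ) * a * p
  collect = solve-∀ ℚ-ring
  term : ∀ i → two * f i + - 1ℚ * g i ≡ (two ^ suc (toℕ i) - 1ℚ) * c i * x ^ toℕ i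
  term i = trans (cong (λ p → two * (c i * p) + - 1ℚ * g i) (^-distrib-* two x (toℕ i)))
                 (collect (c i) (two ^ toℕ i) (x ^ toℕ i))

pol-zero-coefficients : ∀ M {c : Fin (suc M) → ℚ} x → (∀ i → c i ≡ 0ℚ) → pol M c x ≡ 0ℚ
pol-zero-coefficients M x c≗0 = ∑-zero (λ i → trans (cong (_* x ^ toℕ i) (c≗0 i)) (*-zeroˡ (x ^ toℕ i)))

-- Induction on the degree: writing p(x) = c₀ + x·q(x), the identity
-- p(2x) - p(x) = x·(2q(2x) - q(x)) shows that the polynomial 2q(2x) - q(x),
-- with coefficients (2^(i+1) - 1)·c_(i+1), vanishes on positives, so all
-- c_(i+1) vanish; then c₀ = p(1) = 0.
pol-vanishing : ∀ M (c : Fin (suc M) → ℚ) → (∀ x → 0ℚ < x → pol M c x ≡ 0ℚ) → ∀ i → c i ≡ 0ℚ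
pol-vanishing zero c vanish Fin.zero = begin
  c Fin.zero                     ≡⟨ constant-term (c Fin.zero) ⟩
  c Fin.zero * 1ℚ + 0ℚ           ≡⟨ vanish 1ℚ 0<1 ⟩
  0ℚ                             ∎
  where
  constant-term : ∀ a → a ≡ a * 1ℚ + 0ℚ
  constant-term = solve-∀ ℚ-ring
pol-vanishing (suc M) c vanish = coefficient
  where
  q : ℚ → ℚ
  q = pol M (λ i → c (Fin.suc i))
  d : Fin (suc M) → ℚ
  d i = (two ^ suc (toℕ i) - 1ℚ) * c (Fin.suc i)
  0<2x : ∀ {x} → 0ℚ < x → 0ℚ < two * x
  0<2x {x} 0<x = <-≤-trans (+-mono-< 0<x 0<x) (≤-reflexive (twice x))
  difference : ∀ c₀ x a b → x * (two * a - b) ≡ (c₀ + two * x * a) - (c₀ + x * b)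
  difference = solve-∀ ℚ-ring
  horner-at-one : ∀ a → a ≡ a + 1ℚ * 0ℚ
  horner-at-one = solve-∀ ℚ-ring
  d-vanishes : ∀ x → 0ℚ < x → pol M d x ≡ 0ℚ
  d-vanishes x 0<x = *-cancelˡ-zero (positive⇒nonzero 0<x) (begin
    x * pol M d x                                   ≡⟨ cong (x *_) (pol-doubling M (λ i → c (Fin.suc i)) x) ⟨
    x * (two * q (two * x) - q x)                   ≡⟨ difference (c Fin.zero) x (q (two * x)) (q x) ⟩
    (c Fin.zero + two * x * q (two * x)) - (c Fin.zero + x * q x)
                                                    ≡⟨ cong₂ _-_ (pol-horner M c (two * x)) (pol-horner M c x) ⟨
    pol (suc M) c (two * x) - pol (suc M) c x       ≡⟨ cong₂ _-_ (vanish (two * x) (0<2x 0<x)) (vanish x 0<x) ⟩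
    0ℚ - 0ℚ                                         ≡⟨⟩
    0ℚ                                              ∎)
  higher : ∀ i → c (Fin.suc i) ≡ 0ℚ
  higher i = *-cancelˡ-zero (2^[1+n]-1≢0 (toℕ i)) (pol-vanishing M d d-vanishes i)
  coefficient : ∀ i → c i ≡ 0ℚ
  coefficient (Fin.suc i) = higher i
  coefficient Fin.zero = begin
    c Fin.zero                     ≡⟨ horner-at-one (c Fin.zero) ⟩
    c Fin.zero + 1ℚ * 0ℚ           ≡⟨ cong (λ v → c Fin.zero + 1ℚ * v) (pol-zero-coefficients M 1ℚ higher) ⟨
    c Fin.zero + 1ℚ * q 1ℚ         ≡⟨ pol-horner M c 1ℚ ⟨
    pol (suc M) c 1ℚ               ≡⟨ vanish 1ℚ 0<1 ⟩
    0ℚ                             ∎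

numer-homogeneous : ∀ N (c : V' N) t x y → numer N c (t * x) (t * y) ≡ t ^ N * numer N c x y
numer-homogeneous N c t x y = begin
  numer N c (t * x) (t * y)                                  ≡⟨ ∑-cong term ⟩
  ∑ (λ i → t ^ N * (c i * (x ^ toℕ i * y ^ (N ∸ toℕ i))))     ≡⟨ ∑-scale (t ^ N) (λ i → c i * (x ^ toℕ i * y ^ (N ∸ toℕ i))) ⟨
  t ^ N * numer N c x y                                      ∎
  where
  regroup : ∀ a tᵢ xᵢ tⱼ yⱼ → a * ((tᵢ * xᵢ) * (tⱼ * yⱼ)) ≡ (tᵢ * tⱼ) * (a * (xᵢ * yⱼ))
  regroup = solve-∀ ℚ-ring
  term : ∀ i → c i * ((t * x) ^ toℕ i * (t * y) ^ (N ∸ toℕ i))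
             ≡ t ^ N * (c i * (x ^ toℕ i * y ^ (N ∸ toℕ i)))
  term i = begin
    c i * ((t * x) ^ k * (t * y) ^ (N ∸ k))
      ≡⟨ cong₂ (λ u v → c i * (u * v)) (^-distrib-* t x k) (^-distrib-* t y (N ∸ k)) ⟩
    c i * ((t ^ k * x ^ k) * (t ^ (N ∸ k) * y ^ (N ∸ k)))
      ≡⟨ regroup (c i) (t ^ k) (x ^ k) (t ^ (N ∸ k)) (y ^ (N ∸ k)) ⟩
    (t ^ k * t ^ (N ∸ k)) * (c i * (x ^ k * y ^ (N ∸ k)))
      ≡⟨ cong (_* (c i * (x ^ k * y ^ (N ∸ k)))) (^-homo-+ t k (N ∸ k)) ⟨
    t ^ (k ℕ.+ (N ∸ k)) * (c i * (x ^ k * y ^ (N ∸ k)))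
      ≡⟨ cong (λ n → t ^ n * (c i * (x ^ k * y ^ (N ∸ k)))) (m+[n∸m]≡n (toℕ≤pred[n] i)) ⟩
    t ^ N * (c i * (x ^ k * y ^ (N ∸ k)))
      ∎
    where
    k : ℕ
    k = toℕ i

numer-even : ∀ N (c : V' N) → 2 ∣ N → ∀ x y → numer N c (- x) (- y) ≡ numer N c x y
numer-even N c (divides q N≡q*2) x y = begin
  numer N c (- x) (- y)                    ≡⟨ cong₂ (numer N c) (neg-as-scaling x) (neg-as-scaling y) ⟩
  numer N c (- 1ℚ * x) (- 1ℚ * y)          ≡⟨ numer-homogeneous N c (- 1ℚ) x y ⟩
  (- 1ℚ) ^ N * numer N c x y               ≡⟨ cong (λ n → (- 1ℚ) ^ n * numer N c x y) N≡q*2 ⟩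
  (- 1ℚ) ^ (q ℕ.* 2) * numer N c x y       ≡⟨ cong (_* numer N c x y) (-1^even≡1 q) ⟩
  1ℚ * numer N c x y                       ≡⟨ *-identityˡ (numer N c x y) ⟩
  numer N c x y                            ∎
  where
  neg-as-scaling : ∀ a → - a ≡ - 1ℚ * a
  neg-as-scaling = solve-∀ ℚ-ring

ev-even : ∀ N (c : V' N) → 2 ∣ N → ∀ x y → ev N c (- x) (- y) ≡ ev N c x y
ev-even N c 2∣N x y = cong₂ (λ g p → g * inv p) (numer-even N c 2∣N x y) (neg-*-neg x y)
  where
  neg-*-neg : ∀ a b → - a * - b ≡ a * b
  neg-*-neg = solve-∀ ℚ-ring

-- For any even function E, the Fay relations at (x, y) and at (y, x) both
-- consist of E at the given point plus the two terms A = E(x+y, -y) and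
-- B = E(x+y, -x); subtracting them shows that E is symmetric.
fay-symmetric : (E : ℚ → ℚ → ℚ) → (∀ a b → E (- a) (- b) ≡ E a b) → ∀ x y →
  E x y + E (x + y) (- y) + E (- x + - y) x ≡ 0ℚ →
  E y x + E (y + x) (- x) + E (- y + - x) y ≡ 0ℚ →
  E x y ≡ E y x
fay-symmetric E even x y fay-xy fay-yx = begin
  E x y                                    ≡⟨ difference (E x y) (E y x) A B ⟩
  (E x y + A + B) - (E y x + B + A) + E y x ≡⟨ cong₂ (λ u v → u - v + E y x) fay-xy′ fay-yx′ ⟩
  0ℚ - 0ℚ + E y x                          ≡⟨ zero-difference (E y x) ⟩
  E y x                                    ∎
  where
  A B : ℚ
  A = E (x + y) (- y)
  B = E (x + y) (- x)
  difference : ∀ e e′ a b → e ≡ (e + a + b) - (e′ + b + a) + e′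
  difference = solve-∀ ℚ-ring
  zero-difference : ∀ e → 0ℚ - 0ℚ + e ≡ e
  zero-difference = solve-∀ ℚ-ring
  negated-sum : ∀ a b → - a + - b ≡ - (a + b)
  negated-sum = solve-∀ ℚ-ring
  double-negation : ∀ a → a ≡ - (- a)
  double-negation = solve-∀ ℚ-ring
  reflect : ∀ a b → E (- a + - b) a ≡ E (a + b) (- a)
  reflect a b = trans (cong₂ E (negated-sum a b) (double-negation a)) (even (a + b) (- a))
  fay-xy′ : E x y + A + B ≡ 0ℚ
  fay-xy′ = trans (cong (E x y + A +_) (sym (reflect x y))) fay-xy
  fay-yx′ : E y x + B + A ≡ 0ℚ
  fay-yx′ = trans (cong₂ (λ u v → E y x + u + v)
                         (cong (λ s → E s (- x)) (+-comm x y))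
                         (trans (cong (λ s → E s (- y)) (+-comm x y)) (sym (reflect y x))))
                  fay-yx

symmetric-antisymmetric⇒zero : ∀ {a b} → a ≡ b → a + b ≡ 0ℚ → a ≡ 0ℚ
symmetric-antisymmetric⇒zero {a} a≡b a+b≡0 = double-zero (trans (cong (a +_) a≡b) a+b≡0)

ev-vanishes : ∀ N (c : V' N) → 2 ∣ N → FSh₂ N c →
  ∀ x y → x ≢ 0ℚ → y ≢ 0ℚ → x + y ≢ 0ℚ → ev N c x y ≡ 0ℚ
ev-vanishes N c 2∣N (fay , antisymmetric) x y x≢0 y≢0 x+y≢0 =
  symmetric-antisymmetric⇒zero symmetric (antisymmetric x y x≢0 y≢0)
  where
  y+x≢0 : y + x ≢ 0ℚ
  y+x≢0 y+x≡0 = x+y≢0 (trans (+-comm x y) y+x≡0)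
  symmetric : ev N c x y ≡ ev N c y x
  symmetric = fay-symmetric (ev N c) (ev-even N c 2∣N) x y
                (fay x y x≢0 y≢0 x+y≢0) (fay y x y≢0 x≢0 y+x≢0)

numer-vanishes : ∀ N (c : V' N) x y → x ≢ 0ℚ → y ≢ 0ℚ → ev N c x y ≡ 0ℚ → numer N c x y ≡ 0ℚ
numer-vanishes N c x y x≢0 y≢0 ev≡0 = begin
  numer N c x y                            ≡⟨ *-identityʳ (numer N c x y) ⟨
  numer N c x y * 1ℚ                       ≡⟨ cong (numer N c x y *_) (inv-inverseˡ (x * y) (*-nonzero x≢0 y≢0)) ⟨
  numer N c x y * (inv (x * y) * (x * y))  ≡⟨ reassociate (numer N c x y) (inv (x * y)) (x * y) ⟩
  ev N c x y * (x * y)                     ≡⟨ cong (_* (x * y)) ev≡0 ⟩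
  0ℚ * (x * y)                             ≡⟨ *-zeroˡ (x * y) ⟩
  0ℚ                                       ∎
  where
  reassociate : ∀ a b p → a * (b * p) ≡ (a * b) * p
  reassociate = solve-∀ ℚ-ring

numer-at-one : ∀ N (c : V' N) x → numer N c x 1ℚ ≡ pol N c x
numer-at-one N c x = ∑-cong λ i →
  cong (c i *_) (trans (cong (x ^ toℕ i *_) (1^n≡1 (N ∸ toℕ i))) (*-identityʳ (x ^ toℕ i)))

mainTheorem3 : (N : ℕ) → 2 ∣ N → (P : V' N) → FSh₂ N P → IsZero N P
mainTheorem3 N 2∣N P P∈FSh₂ = pol-vanishing N P vanishes-on-positives
  where
  vanishes-on-positives : ∀ x → 0ℚ < x → pol N P x ≡ 0ℚ
  vanishes-on-positives x 0<x = begin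
    pol N P x         ≡⟨ numer-at-one N P x ⟨
    numer N P x 1ℚ    ≡⟨ numer-vanishes N P x 1ℚ x≢0 1≢0 (ev-vanishes N P 2∣N P∈FSh₂ x 1ℚ x≢0 1≢0 x+1≢0) ⟩
    0ℚ                ∎
    where
    x≢0 : x ≢ 0ℚ
    x≢0 = positive⇒nonzero 0<x
    x+1≢0 : x + 1ℚ ≢ 0ℚ
    x+1≢0 = positive⇒nonzero (+-mono-< 0<x 0<1)
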